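{- For every integer $m\geq 1$, there is no contracted bipartite $3$-regular colored graph with $4m$ vertices.
   Context: A $3$-regular colored graph is a loopless $3$-regular multigraph together with a proper edge-coloring $\gamma:E\to\{0,1,2\}$ (adjacent edges receive different colors). It is contracted if, for each pair of colors $i\neq j$, the spanning subgraph consisting of the edges of colors $i$ and $j$ is connected (equivalently, a Hamiltonian cycle). -}

module Defs where

open import Data.Nat using (ℕ)
open import Data.Fin using (Fin; _≟_)
open import Data.List using (length; filter; allFin)
open import Data.Bool using (Bool)
open import Data.Product using (_×_; ∃)
open import Data.Sum using (_⊎_)
open import Relation.Nullary using (¬_)
open import Relation.Nullary.Decidable using (_⊎-dec_)
open import Relation.Binary.PropositionalEquality using (_≡_; _≢_)

Incident : ∀ {n k} → (Fin k → Fin n) → (Fin k → Fin n) → Fin n → Fin k → Set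
Incident end₁ end₂ v e = end₁ e ≡ v ⊎ end₂ e ≡ v

degree : ∀ {n k} → (Fin k → Fin n) → (Fin k → Fin n) → Fin n → ℕ
degree end₁ end₂ v =
  length (filter (λ e → (end₁ e ≟ v) ⊎-dec (end₂ e ≟ v)) (allFin _))

-- A 3-regular colored graph on the vertex set Fin n:
-- a loopless 3-regular multigraph (edges Fin numEdges, each with two
-- endpoints) with a proper edge-colouring by {0,1,2}.
record ColoredGraph (n : ℕ) : Set where
  field
    numEdges : ℕ
    end₁ end₂ : Fin numEdges → Fin n
    colour : Fin numEdges → Fin 3
    loopless : ∀ e → end₁ e ≢ end₂ e
    regular : ∀ v → degree end₁ end₂ v ≡ 3
    proper : ∀ v e f → e ≢ f → Incident end₁ end₂ v e → Incident end₁ end₂ v f →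
             colour e ≢ colour f

module _ {n : ℕ} (G : ColoredGraph n) where
  open ColoredGraph G

  data Walk (i j : Fin 3) : Fin n → Fin n → Set where
    here : ∀ {u} → Walk i j u u
    step : ∀ {u w v} (e : Fin numEdges) →
           (colour e ≡ i ⊎ colour e ≡ j) →
           ((end₁ e ≡ u × end₂ e ≡ w) ⊎ (end₂ e ≡ u × end₁ e ≡ w)) →
           Walk i j w v → Walk i j u v

  ConnectedIJ : Fin 3 → Fin 3 → Set
  ConnectedIJ i j = ∀ u v → Walk i j u v

  Contracted : Set
  Contracted = ∀ i j → i ≢ j → ConnectedIJ i j

  Bipartite : Set
  Bipartite = ∃ λ (side : Fin n → Bool) → ∀ e → side (end₁ e) ≢ side (end₂ e)

module Submission where

-- Call the two sides of the bipartition black and white, and let neighbour c send a vertex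
-- along its edge of colour c.  For colours i ≠ j, the permutation rotation i j acts as
-- neighbour j ∘ neighbour i on black vertices and fixes white ones; its orbits are the black
-- vertices of the (i,j)-coloured cycles.  In a contracted graph on 4m vertices there is a single
-- such cycle, so rotation i j is one cycle through all 2m black vertices and is odd.  But
-- rotation 0 2 = rotation 1 2 ∘ rotation 0 1, and the sign (here: the parity of the number of
-- inversions) is multiplicative, so odd = odd + odd, which is absurd.

open import Defs
open import Data.Nat using (ℕ; _*_; _≤_)
open import Data.Product using (_×_)
open import Relation.Nullary using (¬_)

open import Data.Bool using (Bool; true; false; not; _∧_; _xor_; if_then_else_)
open import Data.Bool.Properties
  using (¬-not; not-involutive; ∧-zeroʳ; ∧-distribˡ-xor; xor-annihilates-not; true-xor; xor-inverseˡ; xor-assoc)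
open import Data.Empty using (⊥-elim)
open import Data.Fin using (Fin; zero; suc; toℕ; fromℕ<)
open import Data.Fin.Patterns using (0F; 1F; 2F)
open import Data.Fin.Permutation
  using (Permutation′; permutation; _⟨$⟩ʳ_; _⟨$⟩ˡ_; inverseʳ; _∘ₚ_; flip; transpose; _≈_; ↔⇒≡)
  renaming (id to idₚ)
import Data.Fin.Permutation.Components as PC
open import Data.Fin.Properties
  using (_≟_; _<?_; <-irrefl; <-cmp; pigeonhole; all?; toℕ<n; toℕ-injective; toℕ-fromℕ<; +↔⊎)
open import Data.List using ([]; _∷_; length; filter; allFin)
open import Data.List.Membership.Propositional using (_∈_)
open import Data.List.Membership.Propositional.Properties using (∈-filter⁻)
open import Data.List.Relation.Unary.All using ([]; _∷_)
open import Data.List.Relation.Unary.AllPairs using ([]; _∷_)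
open import Data.List.Relation.Unary.Any using (here; there)
open import Data.List.Relation.Unary.Unique.Propositional using (Unique)
open import Data.List.Relation.Unary.Unique.Propositional.Properties using (filter⁺; allFin⁺)
open import Data.Nat using (zero; suc; _+_; _<_; z≤n; s≤s; parity; ⌊_/2⌋)
open import Data.Nat.Properties
  using (+-0-commutativeMonoid; +-identityʳ; +-assoc; +-suc; n≡⌊n+n/2⌋; suc-injective; n<1+n; m≤n+m;
         ≤-trans; ≤-reflexive; ≤-pred; <⇒≤; m≤n⇒m<n∨m≡n; m≤n⇒∃[o]m+o≡n)
  renaming (<-cmp to <-cmpℕ)
open import Data.Parity.Base as ℙ using (Parity; 0ℙ; 1ℙ; _⁻¹)
import Data.Parity.Properties as ℙₚ
open import Data.Product using (∃-syntax; _,_; proj₁; proj₂)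
open import Data.Sum as Sum using (_⊎_; inj₁; inj₂)
open import Function using (_∘_)
open import Function.Bundles using (Injection; _↔_; mk↔ₛ′)
open import Function.Construct.Composition using (_↔-∘_)
import Function.Endo.Propositional as Endo
open import Function.Properties.Inverse using (↔⇒↣)
open import Relation.Binary.Definitions using (tri<; tri≈; tri>)
open import Relation.Binary.PropositionalEquality
open import Relation.Nullary using (¬?; Dec; yes; no; does; contradiction)
open import Relation.Nullary.Decidable using (dec-true; dec-false; toWitness; _→-dec_; _⊎-dec_)
open import Relation.Unary using (Decidable)
open import Algebra.Properties.CommutativeMonoid.Sum +-0-commutativeMonoid
  using (sum; sum-cong-≗; sum-permute; sum-replicate-zero; ∑-comm; ∑-distrib-+)
open import Algebra.Properties.CommutativeSemigroup ℙₚ.+-commutativeSemigroup using (interchange; x∙yz≈y∙xz)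

open ≡-Reasoning

𝟙 : Bool → ℕ
𝟙 b = if b then 1 else 0

m+m≡n+n⇒m≡n : ∀ {m n} → m + m ≡ n + n → m ≡ n
m+m≡n+n⇒m≡n {m} {n} eq = trans (n≡⌊n+n/2⌋ m) (trans (cong ⌊_/2⌋ eq) (sym (n≡⌊n+n/2⌋ n)))

parity-odd : ∀ m → parity (suc (m + m)) ≡ 1ℙ
parity-odd m = begin
  parity (suc (m + m))  ≡⟨ ℙₚ.⁻¹-selfInverse (ℙₚ.suc-homo-⁻¹ (m + m)) ⟨
  parity (m + m) ⁻¹     ≡⟨ cong _⁻¹ (trans (ℙₚ.+-homo-+ m m) (ℙₚ.p+p≡0ℙ (parity m))) ⟩
  1ℙ                    ∎

parity-𝟙-xor : ∀ a b → parity (𝟙 (a xor b)) ≡ parity (𝟙 a) ℙ.+ parity (𝟙 b)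
parity-𝟙-xor false b     = refl
parity-𝟙-xor true  false = refl
parity-𝟙-xor true  true  = refl

parity-sum-+ : ∀ {n} (f g h : Fin n → ℕ) → (∀ i → parity (f i) ≡ parity (g i) ℙ.+ parity (h i)) →
               parity (sum f) ≡ parity (sum g) ℙ.+ parity (sum h)
parity-sum-+ {zero}  f g h eq = refl
parity-sum-+ {suc n} f g h eq = begin
  parity (f zero + sum (f ∘ suc))
    ≡⟨ ℙₚ.+-homo-+ (f zero) _ ⟩
  parity (f zero) ℙ.+ parity (sum (f ∘ suc))
    ≡⟨ cong₂ ℙ._+_ (eq zero) (parity-sum-+ (f ∘ suc) (g ∘ suc) (h ∘ suc) (eq ∘ suc)) ⟩
  (parity (g zero) ℙ.+ parity (h zero)) ℙ.+ (parity (sum (g ∘ suc)) ℙ.+ parity (sum (h ∘ suc)))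
    ≡⟨ interchange (parity (g zero)) (parity (h zero)) _ _ ⟩
  (parity (g zero) ℙ.+ parity (sum (g ∘ suc))) ℙ.+ (parity (h zero) ℙ.+ parity (sum (h ∘ suc)))
    ≡⟨ cong₂ ℙ._+_ (ℙₚ.+-homo-+ (g zero) _) (ℙₚ.+-homo-+ (h zero) _) ⟨
  parity (sum g) ℙ.+ parity (sum h)
    ∎

-- The sign of a permutation

module _ {n : ℕ} where

  infix 8 _<ᵇ_
  _<ᵇ_ : Fin n → Fin n → Bool
  i <ᵇ j = does (i <? j)

  <ᵇ-irrefl : ∀ i → (i <ᵇ i) ≡ false
  <ᵇ-irrefl i = dec-false (i <? i) (<-irrefl refl)

  <ᵇ-asym : ∀ i j → (i <ᵇ j ∧ j <ᵇ i) ≡ false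
  <ᵇ-asym i j with <-cmp i j
  ... | tri< _ _ j≮i rewrite dec-false (j <? i) j≮i = ∧-zeroʳ (i <ᵇ j)
  ... | tri≈ i≮j _ _ rewrite dec-false (i <? j) i≮j = refl
  ... | tri> i≮j _ _ rewrite dec-false (i <? j) i≮j = refl

  <ᵇ-flip : ∀ {i j} → i ≢ j → (j <ᵇ i) ≡ not (i <ᵇ j)
  <ᵇ-flip {i} {j} i≢j with <-cmp i j
  ... | tri< i<j _ j≮i rewrite dec-true (i <? j) i<j | dec-false (j <? i) j≮i = refl
  ... | tri≈ _ i≡j _   = ⊥-elim (i≢j i≡j)
  ... | tri> i≮j _ j<i rewrite dec-false (i <? j) i≮j | dec-true (j <? i) j<i = refl

  ⟨$⟩ʳ-injective : ∀ (π : Permutation′ n) {i j} → π ⟨$⟩ʳ i ≡ π ⟨$⟩ʳ j → i ≡ j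
  ⟨$⟩ʳ-injective π = Injection.injective (↔⇒↣ π)

  Σ² : (Fin n → Fin n → ℕ) → ℕ
  Σ² F = sum λ i → sum (F i)

  Σ²-cong : ∀ {F G} → (∀ i j → F i j ≡ G i j) → Σ² F ≡ Σ² G
  Σ²-cong eq = sum-cong-≗ λ i → sum-cong-≗ (eq i)

  Σ²-+ : ∀ F G → Σ² (λ i j → F i j + G i j) ≡ Σ² F + Σ² G
  Σ²-+ F G = trans (sum-cong-≗ λ i → ∑-distrib-+ (F i) (G i)) (∑-distrib-+ (λ i → sum (F i)) (λ i → sum (G i)))

  Σ²-permute : ∀ (π : Permutation′ n) F → Σ² F ≡ Σ² (λ i j → F (π ⟨$⟩ʳ i) (π ⟨$⟩ʳ j))
  Σ²-permute π F = trans (sum-permute (λ i → sum (F i)) π) (sum-cong-≗ λ i → sum-permute (F (π ⟨$⟩ʳ i)) π)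

  parity-Σ²-+ : ∀ F G H → (∀ i j → parity (F i j) ≡ parity (G i j) ℙ.+ parity (H i j)) →
                parity (Σ² F) ≡ parity (Σ² G) ℙ.+ parity (Σ² H)
  parity-Σ²-+ F G H eq = parity-sum-+ _ _ _ λ i → parity-sum-+ (F i) (G i) (H i) (eq i)

  pairs : (Fin n → Fin n → Bool) → ℕ
  pairs V = Σ² λ i j → 𝟙 (i <ᵇ j ∧ V i j)

  Σ²-symmetric : ∀ V → (∀ i j → V i j ≡ V j i) → (∀ i → V i i ≡ false) →
                 Σ² (λ i j → 𝟙 (V i j)) ≡ pairs V + pairs V
  Σ²-symmetric V V-sym V-irrefl = begin
    Σ² (λ i j → 𝟙 (V i j))                                ≡⟨ Σ²-cong split ⟩
    Σ² (λ i j → 𝟙 (i <ᵇ j ∧ V i j) + 𝟙 (j <ᵇ i ∧ V i j)) ≡⟨ Σ²-+ _ _ ⟩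
    pairs V + Σ² (λ i j → 𝟙 (j <ᵇ i ∧ V i j))             ≡⟨ cong (pairs V +_) transposed ⟩
    pairs V + pairs V                                     ∎
    where
    𝟙-split : ∀ b v → 𝟙 v ≡ 𝟙 (b ∧ v) + 𝟙 (not b ∧ v)
    𝟙-split false false = refl
    𝟙-split false true  = refl
    𝟙-split true  false = refl
    𝟙-split true  true  = refl

    split : ∀ i j → 𝟙 (V i j) ≡ 𝟙 (i <ᵇ j ∧ V i j) + 𝟙 (j <ᵇ i ∧ V i j)
    split i j with i ≟ j
    ... | yes refl rewrite V-irrefl i | <ᵇ-irrefl i = refl
    ... | no i≢j   rewrite <ᵇ-flip i≢j              = 𝟙-split (i <ᵇ j) (V i j)

    transposed : Σ² (λ i j → 𝟙 (j <ᵇ i ∧ V i j)) ≡ pairs V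
    transposed = trans (∑-comm (λ i j → 𝟙 (j <ᵇ i ∧ V i j)))
                       (Σ²-cong λ i j → cong (λ b → 𝟙 (i <ᵇ j ∧ b)) (V-sym j i))

  -- Both sides are half of the full double sum, which a permutation of the indices only reorders.
  pairs-permute : ∀ (π : Permutation′ n) V → (∀ i j → V i j ≡ V j i) → (∀ i → V i i ≡ false) →
                  pairs (λ i j → V (π ⟨$⟩ʳ i) (π ⟨$⟩ʳ j)) ≡ pairs V
  pairs-permute π V V-sym V-irrefl = m+m≡n+n⇒m≡n (begin
    pairs Vπ + pairs Vπ       ≡⟨ Σ²-symmetric Vπ (λ i j → V-sym _ _) (λ i → V-irrefl _) ⟨
    Σ² (λ i j → 𝟙 (Vπ i j))   ≡⟨ Σ²-permute π (λ x y → 𝟙 (V x y)) ⟨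
    Σ² (λ x y → 𝟙 (V x y))    ≡⟨ Σ²-symmetric V V-sym V-irrefl ⟩
    pairs V + pairs V         ∎)
    where
    Vπ : Fin n → Fin n → Bool
    Vπ i j = V (π ⟨$⟩ʳ i) (π ⟨$⟩ʳ j)

  inversions : (Fin n → Fin n) → ℕ
  inversions f = pairs λ i j → f j <ᵇ f i

  sgn : Permutation′ n → Parity
  sgn π = parity (inversions (π ⟨$⟩ʳ_))

  Discordant : Permutation′ n → Fin n → Fin n → Bool
  Discordant σ x y = x <ᵇ y xor (σ ⟨$⟩ʳ x) <ᵇ (σ ⟨$⟩ʳ y)

  Discordant-irrefl : ∀ σ x → Discordant σ x x ≡ false
  Discordant-irrefl σ x rewrite <ᵇ-irrefl x | <ᵇ-irrefl (σ ⟨$⟩ʳ x) = refl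

  Discordant-sym : ∀ σ x y → Discordant σ x y ≡ Discordant σ y x
  Discordant-sym σ x y with x ≟ y
  ... | yes refl = refl
  ... | no x≢y rewrite <ᵇ-flip x≢y | <ᵇ-flip (x≢y ∘ ⟨$⟩ʳ-injective σ) =
    sym (xor-annihilates-not (x <ᵇ y) ((σ ⟨$⟩ʳ x) <ᵇ (σ ⟨$⟩ʳ y)))

  pairs-Discordant : ∀ σ → pairs (Discordant σ) ≡ inversions (σ ⟨$⟩ʳ_)
  pairs-Discordant σ = Σ²-cong pointwise
    where
    pointwise : ∀ i j → 𝟙 (i <ᵇ j ∧ Discordant σ i j) ≡ 𝟙 (i <ᵇ j ∧ (σ ⟨$⟩ʳ j) <ᵇ (σ ⟨$⟩ʳ i))
    pointwise i j with i ≟ j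
    ... | yes refl rewrite <ᵇ-irrefl i = refl
    ... | no i≢j rewrite <ᵇ-flip (i≢j ∘ ⟨$⟩ʳ-injective σ) with i <ᵇ j
    ...   | true  = refl
    ...   | false = refl

  Discordant-∘ₚ : ∀ (π σ : Permutation′ n) i j →
                  ((π ∘ₚ σ) ⟨$⟩ʳ j) <ᵇ ((π ∘ₚ σ) ⟨$⟩ʳ i) ≡
                  (π ⟨$⟩ʳ j) <ᵇ (π ⟨$⟩ʳ i) xor Discordant σ (π ⟨$⟩ʳ i) (π ⟨$⟩ʳ j)
  Discordant-∘ₚ π σ i j with i ≟ j
  ... | yes refl rewrite <ᵇ-irrefl (σ ⟨$⟩ʳ (π ⟨$⟩ʳ i)) | <ᵇ-irrefl (π ⟨$⟩ʳ i) = refl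
  ... | no i≢j = begin
    (σ ⟨$⟩ʳ y) <ᵇ (σ ⟨$⟩ʳ x)   ≡⟨ <ᵇ-flip (i≢j ∘ ⟨$⟩ʳ-injective (π ∘ₚ σ)) ⟩
    not Q                       ≡⟨ true-xor Q ⟨
    true xor Q                  ≡⟨ cong (_xor Q) (xor-inverseˡ P) ⟨
    (not P xor P) xor Q         ≡⟨ xor-assoc (not P) P Q ⟩
    not P xor (P xor Q)         ≡⟨ cong (_xor Discordant σ x y) (<ᵇ-flip (i≢j ∘ ⟨$⟩ʳ-injective π)) ⟨
    y <ᵇ x xor Discordant σ x y ∎
    where
    x = π ⟨$⟩ʳ i
    y = π ⟨$⟩ʳ j
    P = x <ᵇ y
    Q = (σ ⟨$⟩ʳ x) <ᵇ (σ ⟨$⟩ʳ y)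

  sgn-∘ₚ : ∀ π σ → sgn (π ∘ₚ σ) ≡ sgn π ℙ.+ sgn σ
  sgn-∘ₚ π σ = begin
    sgn (π ∘ₚ σ)                                            ≡⟨ parity-Σ²-+ _ _ _ pointwise ⟩
    sgn π ℙ.+ parity (pairs λ i j → Discordant σ (f i) (f j)) ≡⟨ cong (λ k → sgn π ℙ.+ parity k) reindexed ⟩
    sgn π ℙ.+ sgn σ                                         ∎
    where
    f = π ⟨$⟩ʳ_

    reindexed : pairs (λ i j → Discordant σ (f i) (f j)) ≡ inversions (σ ⟨$⟩ʳ_)
    reindexed = trans (pairs-permute π (Discordant σ) (Discordant-sym σ) (Discordant-irrefl σ))
                      (pairs-Discordant σ)

    pointwise : ∀ i j → parity (𝟙 (i <ᵇ j ∧ ((π ∘ₚ σ) ⟨$⟩ʳ j) <ᵇ ((π ∘ₚ σ) ⟨$⟩ʳ i))) ≡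
                        parity (𝟙 (i <ᵇ j ∧ f j <ᵇ f i)) ℙ.+ parity (𝟙 (i <ᵇ j ∧ Discordant σ (f i) (f j)))
    pointwise i j = begin
      parity (𝟙 (i <ᵇ j ∧ ((π ∘ₚ σ) ⟨$⟩ʳ j) <ᵇ ((π ∘ₚ σ) ⟨$⟩ʳ i)))
        ≡⟨ cong (λ b → parity (𝟙 (i <ᵇ j ∧ b))) (Discordant-∘ₚ π σ i j) ⟩
      parity (𝟙 (i <ᵇ j ∧ (f j <ᵇ f i xor Discordant σ (f i) (f j))))
        ≡⟨ cong (parity ∘ 𝟙) (∧-distribˡ-xor (i <ᵇ j) (f j <ᵇ f i) (Discordant σ (f i) (f j))) ⟩
      parity (𝟙 ((i <ᵇ j ∧ f j <ᵇ f i) xor (i <ᵇ j ∧ Discordant σ (f i) (f j))))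
        ≡⟨ parity-𝟙-xor (i <ᵇ j ∧ f j <ᵇ f i) (i <ᵇ j ∧ Discordant σ (f i) (f j)) ⟩
      parity (𝟙 (i <ᵇ j ∧ f j <ᵇ f i)) ℙ.+ parity (𝟙 (i <ᵇ j ∧ Discordant σ (f i) (f j)))
        ∎

  sgn-cong : ∀ {π σ} → π ≈ σ → sgn π ≡ sgn σ
  sgn-cong π≈σ = cong parity (Σ²-cong λ i j → cong (λ b → 𝟙 (i <ᵇ j ∧ b)) (cong₂ _<ᵇ_ (π≈σ j) (π≈σ i)))

  sgn-id : sgn idₚ ≡ 0ℙ
  sgn-id = cong parity (begin
    Σ² (λ i j → 𝟙 (i <ᵇ j ∧ j <ᵇ i))  ≡⟨ Σ²-cong (λ i j → cong 𝟙 (<ᵇ-asym i j)) ⟩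
    Σ² (λ _ _ → 0)                    ≡⟨ sum-cong-≗ {n} (λ _ → sum-replicate-zero n) ⟩
    sum {n} (λ _ → 0)                 ≡⟨ sum-replicate-zero n ⟩
    0                                 ∎)

  sgn-conjugate : ∀ π σ → sgn (flip π ∘ₚ σ ∘ₚ π) ≡ sgn σ
  sgn-conjugate π σ = begin
    sgn (flip π ∘ₚ σ ∘ₚ π)              ≡⟨ sgn-∘ₚ (flip π) (σ ∘ₚ π) ⟩
    sgn (flip π) ℙ.+ sgn (σ ∘ₚ π)       ≡⟨ cong (sgn (flip π) ℙ.+_) (sgn-∘ₚ σ π) ⟩
    sgn (flip π) ℙ.+ (sgn σ ℙ.+ sgn π)  ≡⟨ x∙yz≈y∙xz (sgn (flip π)) (sgn σ) (sgn π) ⟩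
    sgn σ ℙ.+ (sgn (flip π) ℙ.+ sgn π)  ≡⟨ cong (sgn σ ℙ.+_) (sgn-∘ₚ (flip π) π) ⟨
    sgn σ ℙ.+ sgn (flip π ∘ₚ π)         ≡⟨ cong (sgn σ ℙ.+_) (sgn-cong {flip π ∘ₚ π} {idₚ} (λ _ → inverseʳ π)) ⟩
    sgn σ ℙ.+ sgn idₚ                   ≡⟨ cong (sgn σ ℙ.+_) sgn-id ⟩
    sgn σ ℙ.+ 0ℙ                        ≡⟨ ℙₚ.+-identityʳ (sgn σ) ⟩
    sgn σ                               ∎

  transpose-matchˡ : ∀ (i j : Fin n) → transpose i j ⟨$⟩ʳ i ≡ j
  transpose-matchˡ i j rewrite dec-true (i ≟ i) refl = refl

  transpose-matchʳ : ∀ (i j : Fin n) → transpose i j ⟨$⟩ʳ j ≡ i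
  transpose-matchʳ i j with j ≟ i
  ... | yes j≡i = j≡i
  ... | no _ rewrite dec-true (j ≟ j) refl = refl

  transpose-other : ∀ {i j k : Fin n} → k ≢ i → k ≢ j → transpose i j ⟨$⟩ʳ k ≡ k
  transpose-other {i} {j} {k} k≢i k≢j rewrite dec-false (k ≟ i) k≢i | dec-false (k ≟ j) k≢j = refl

  transpose-natural : ∀ (π : Permutation′ n) i j k →
                      π ⟨$⟩ʳ (transpose i j ⟨$⟩ʳ k) ≡ transpose (π ⟨$⟩ʳ i) (π ⟨$⟩ʳ j) ⟨$⟩ʳ (π ⟨$⟩ʳ k)
  transpose-natural π i j k = natural k (k ≟ i) (k ≟ j)
    where
    natural : ∀ k → Dec (k ≡ i) → Dec (k ≡ j) →
              π ⟨$⟩ʳ (transpose i j ⟨$⟩ʳ k) ≡ transpose (π ⟨$⟩ʳ i) (π ⟨$⟩ʳ j) ⟨$⟩ʳ (π ⟨$⟩ʳ k)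
    natural _ (yes refl) _          = trans (cong (π ⟨$⟩ʳ_) (transpose-matchˡ i j))
                                            (sym (transpose-matchˡ (π ⟨$⟩ʳ i) (π ⟨$⟩ʳ j)))
    natural _ (no _)     (yes refl) = trans (cong (π ⟨$⟩ʳ_) (transpose-matchʳ i j))
                                            (sym (transpose-matchʳ (π ⟨$⟩ʳ i) (π ⟨$⟩ʳ j)))
    natural k (no k≢i)   (no k≢j)   = trans (cong (π ⟨$⟩ʳ_) (transpose-other k≢i k≢j))
      (sym (transpose-other (k≢i ∘ ⟨$⟩ʳ-injective π) (k≢j ∘ ⟨$⟩ʳ-injective π)))

  transpose-conjugate : ∀ (π : Permutation′ n) i j →
                        flip π ∘ₚ transpose i j ∘ₚ π ≈ transpose (π ⟨$⟩ʳ i) (π ⟨$⟩ʳ j)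
  transpose-conjugate π i j v =
    trans (transpose-natural π i j (π ⟨$⟩ˡ v)) (cong (transpose _ _ ⟨$⟩ʳ_) (inverseʳ π))

sgn-transpose₀₁ : ∀ k → sgn (transpose {suc (suc k)} 0F 1F) ≡ 1ℙ
sgn-transpose₀₁ k = cong parity (cong₂ _+_ row₀ (cong₂ _+_ row₁ rows))
  where
  τ = transpose {suc (suc k)} 0F 1F

  row₀ : sum (λ j → 𝟙 (0F <ᵇ j ∧ (τ ⟨$⟩ʳ j) <ᵇ (τ ⟨$⟩ʳ 0F))) ≡ 1
  row₀ = cong suc (sum-replicate-zero k)

  row₁ : sum (λ j → 𝟙 (1F <ᵇ j ∧ (τ ⟨$⟩ʳ j) <ᵇ (τ ⟨$⟩ʳ 1F))) ≡ 0
  row₁ = sum-replicate-zero k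

  rows : sum {k} (λ i → sum {k} (λ j → 𝟙 (suc (suc i) <ᵇ suc (suc j) ∧ suc (suc j) <ᵇ suc (suc i)))) ≡ 0
  rows = trans (sum-cong-≗ {k} λ i → trans (sum-cong-≗ {k} λ j → cong 𝟙 (<ᵇ-asym (suc (suc i)) (suc (suc j))))
                                          (sum-replicate-zero k))
               (sum-replicate-zero k)

sgn-transpose : ∀ {n} {i j : Fin n} → i ≢ j → sgn (transpose i j) ≡ 1ℙ
sgn-transpose {suc zero} {zero} {zero} i≢j = ⊥-elim (i≢j refl)
sgn-transpose {suc (suc k)} {i} {j} i≢j = begin
  sgn (transpose i j)
    ≡⟨ cong₂ (λ x y → sgn (transpose x y)) π₀ π₁ ⟨
  sgn (transpose (π ⟨$⟩ʳ 0F) (π ⟨$⟩ʳ 1F))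
    ≡⟨ sgn-cong {π = flip π ∘ₚ τ₀₁ ∘ₚ π} {transpose _ _} (transpose-conjugate π 0F 1F) ⟨
  sgn (flip π ∘ₚ τ₀₁ ∘ₚ π)                   ≡⟨ sgn-conjugate π τ₀₁ ⟩
  sgn τ₀₁                                    ≡⟨ sgn-transpose₀₁ k ⟩
  1ℙ                                         ∎
  where
  τ₀₁ : Permutation′ (suc (suc k))
  τ₀₁ = transpose 0F 1F

  z : Fin (suc (suc k))
  z = transpose i 0F ⟨$⟩ʳ j

  π : Permutation′ (suc (suc k))
  π = transpose 1F z ∘ₚ transpose 0F i

  z≢0 : z ≢ 0F
  z≢0 z≡0 = i≢j (⟨$⟩ʳ-injective (transpose i 0F) (trans (transpose-matchˡ i 0F) (sym z≡0)))

  π₀ : π ⟨$⟩ʳ 0F ≡ i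
  π₀ = trans (cong (transpose 0F i ⟨$⟩ʳ_) (transpose-other {i = 1F} {z} (λ ()) (z≢0 ∘ sym))) (transpose-matchˡ 0F i)

  π₁ : π ⟨$⟩ʳ 1F ≡ j
  π₁ = trans (cong (transpose 0F i ⟨$⟩ʳ_) (transpose-matchˡ 1F z)) (PC.transpose-inverse 0F i)

-- Cycles and orbits

least-witness : ∀ {p} {P : ℕ → Set p} → Decidable P → ∀ {m} → P m →
                ∃[ k ] P k × (∀ {j} → j < k → ¬ P j)
least-witness P? {zero}  p = zero , p , λ ()
least-witness P? {suc m} p with P? zero
... | yes p₀ = zero , p₀ , λ ()
... | no ¬p₀ with k , pk , below ← least-witness (P? ∘ suc) {m} p =
  suc k , pk , λ { {zero} _ → ¬p₀ ; {suc j} (s≤s j<k) → below j<k }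

module _ {n : ℕ} where

  open Endo (Fin n) using (_^_)

  orbit : Permutation′ n → Fin n → ℕ → Fin n
  orbit σ u k = ((σ ⟨$⟩ʳ_) ^ k) u

  record IsCycle (σ : Permutation′ n) (u : Fin n) (L : ℕ) : Set where
    field
      closes   : orbit σ u (suc L) ≡ u
      distinct : ∀ {k l} → k ≤ L → l ≤ L → orbit σ u k ≡ orbit σ u l → k ≡ l
      support  : ∀ v → (∃[ k ] k ≤ L × orbit σ u k ≡ v) ⊎ σ ⟨$⟩ʳ v ≡ v

  IsCycle-shorten : ∀ {σ u L} → IsCycle σ u (suc L) → IsCycle (σ ∘ₚ transpose u (σ ⟨$⟩ʳ u)) (σ ⟨$⟩ʳ u) L
  IsCycle-shorten {σ} {u} {L} c = record
    { closes   = trans (cong (τ ⟨$⟩ʳ_) (trans (cong (σ ⟨$⟩ʳ_) (shift L (≤-reflexive refl))) closes))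
                       (transpose-matchˡ u w)
    ; distinct = λ k≤L l≤L eq → suc-injective
                   (distinct (s≤s k≤L) (s≤s l≤L) (trans (sym (shift _ k≤L)) (trans eq (shift _ l≤L))))
    ; support  = support′
    }
    where
    open IsCycle c
    w = σ ⟨$⟩ʳ u
    τ = transpose u w
    σ′ = σ ∘ₚ τ

    orbit≢u : ∀ {k} → k ≤ L → orbit σ u (suc k) ≢ u
    orbit≢u k≤L eq with () ← distinct (s≤s k≤L) z≤n eq

    shift : ∀ k → k ≤ L → orbit σ′ w k ≡ orbit σ u (suc k)
    shift zero    _   = refl
    shift (suc k) k<L = trans (cong (λ x → τ ⟨$⟩ʳ (σ ⟨$⟩ʳ x)) (shift k (<⇒≤ k<L)))
                              (transpose-other (orbit≢u k<L) (orbit≢u (<⇒≤ k<L) ∘ ⟨$⟩ʳ-injective σ))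

    support′ : ∀ v → (∃[ k ] k ≤ L × orbit σ′ w k ≡ v) ⊎ σ′ ⟨$⟩ʳ v ≡ v
    support′ v with support v
    ... | inj₁ (zero , _ , refl)        = inj₂ (transpose-matchʳ u w)
    ... | inj₁ (suc k , s≤s k≤L , eq) = inj₁ (k , k≤L , trans (shift k k≤L) eq)
    ... | inj₂ fixed                    = inj₂ (trans (cong (τ ⟨$⟩ʳ_) fixed) (transpose-other v≢u v≢w))
      where
      v≢u : v ≢ u
      v≢u refl = orbit≢u z≤n fixed
      v≢w : v ≢ w
      v≢w refl = orbit≢u z≤n (⟨$⟩ʳ-injective σ fixed)

  sgn-cycle : ∀ L {σ u} → IsCycle σ u L → sgn σ ≡ parity L
  sgn-cycle zero {σ} c = trans (sgn-cong {π = σ} {idₚ} fixes-all) (sgn-id {n})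
    where
    open IsCycle c
    fixes-all : ∀ v → σ ⟨$⟩ʳ v ≡ v
    fixes-all v with support v
    ... | inj₁ (zero , _ , refl) = closes
    ... | inj₂ fixed             = fixed
  sgn-cycle (suc L) {σ} {u} c = begin
    sgn σ           ≡⟨ ℙₚ.⁻¹-selfInverse flipped ⟨
    parity L ⁻¹     ≡⟨ ℙₚ.⁻¹-selfInverse (ℙₚ.suc-homo-⁻¹ L) ⟩
    parity (suc L)  ∎
    where
    open IsCycle c
    τ = transpose u (σ ⟨$⟩ʳ u)

    u≢σu : u ≢ σ ⟨$⟩ʳ u
    u≢σu eq with () ← distinct z≤n (s≤s z≤n) eq

    flipped : sgn σ ⁻¹ ≡ parity L
    flipped = begin
      sgn σ ⁻¹         ≡⟨ ℙₚ.+-comm 1ℙ (sgn σ) ⟩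
      sgn σ ℙ.+ 1ℙ     ≡⟨ cong (sgn σ ℙ.+_) (sgn-transpose u≢σu) ⟨
      sgn σ ℙ.+ sgn τ  ≡⟨ sgn-∘ₚ σ τ ⟨
      sgn (σ ∘ₚ τ)     ≡⟨ sgn-cycle L (IsCycle-shorten c) ⟩
      parity L         ∎

  orbit-cancel : ∀ σ u i {d} → orbit σ u i ≡ orbit σ u (i + d) → orbit σ u d ≡ u
  orbit-cancel σ u zero    eq = sym eq
  orbit-cancel σ u (suc i) eq = orbit-cancel σ u i (⟨$⟩ʳ-injective σ eq)

  orbit-returns : ∀ σ u → ∃[ d ] orbit σ u (suc d) ≡ u
  orbit-returns σ u with i , j , i<j , eq ← pigeonhole (n<1+n n) (orbit σ u ∘ toℕ)
                    with d , i+d≡j ← m≤n⇒∃[o]m+o≡n i<j =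
    d , orbit-cancel σ u (toℕ i) (trans eq (cong (orbit σ u) (trans (sym i+d≡j) (sym (+-suc (toℕ i) d)))))

  module Orbit (σ : Permutation′ n) (u : Fin n) where

    private
      first-return : ∃[ d ] orbit σ u (suc d) ≡ u × (∀ {j} → j < d → orbit σ u (suc j) ≢ u)
      first-return = let d , returns = orbit-returns σ u in least-witness (λ d → orbit σ u (suc d) ≟ u) {d} returns

    L : ℕ
    L = proj₁ first-return

    closes : orbit σ u (suc L) ≡ u
    closes = proj₁ (proj₂ first-return)

    private
      no-early-return : ∀ {k l} → k < l → l ≤ L → orbit σ u k ≢ orbit σ u l
      no-early-return {k} k<l l≤L eq with d , k+d≡l ← m≤n⇒∃[o]m+o≡n k<l =
        proj₂ (proj₂ first-return) (≤-trans (s≤s (m≤n+m d k)) (≤-trans (≤-reflexive k+d≡l) l≤L))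
              (orbit-cancel σ u k (trans eq (cong (orbit σ u) (trans (sym k+d≡l) (sym (+-suc k d))))))

    distinct : ∀ {k l} → k ≤ L → l ≤ L → orbit σ u k ≡ orbit σ u l → k ≡ l
    distinct {k} {l} k≤L l≤L eq with <-cmpℕ k l
    ... | tri< k<l _ _ = ⊥-elim (no-early-return k<l l≤L eq)
    ... | tri≈ _ k≡l _ = k≡l
    ... | tri> _ _ l<k = ⊥-elim (no-early-return l<k k≤L (sym eq))

    reduce : ∀ k → ∃[ k′ ] k′ ≤ L × orbit σ u k ≡ orbit σ u k′
    reduce zero = zero , z≤n , refl
    reduce (suc k) with k′ , k′≤L , eq ← reduce k with m≤n⇒m<n∨m≡n k′≤L
    ... | inj₁ k′<L = suc k′ , k′<L , cong (σ ⟨$⟩ʳ_) eq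
    ... | inj₂ refl = zero , z≤n , trans (cong (σ ⟨$⟩ʳ_) eq) closes

    predecessor : ∀ k → ∃[ k′ ] orbit σ u (suc k′) ≡ orbit σ u k
    predecessor zero    = L , closes
    predecessor (suc k) = k , refl

-- Colour classes and bicoloured rotations

Fin3-covered : ∀ (x y z c : Fin 3) → x ≢ y → x ≢ z → y ≢ z → c ≡ x ⊎ c ≡ y ⊎ c ≡ z
Fin3-covered = toWitness {a? = all? λ x → all? λ y → all? λ z → all? λ c →
  ¬? (x ≟ y) →-dec ¬? (x ≟ z) →-dec ¬? (y ≟ z) →-dec (c ≟ x ⊎-dec c ≟ y ⊎-dec c ≟ z)} _

module _ {n : ℕ} (G : ColoredGraph n) where

  open ColoredGraph G

  Joins : Fin numEdges → Fin n → Fin n → Set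
  Joins e x y = (end₁ e ≡ x × end₂ e ≡ y) ⊎ (end₂ e ≡ x × end₁ e ≡ y)

  Joins-sym : ∀ {e x y} → Joins e x y → Joins e y x
  Joins-sym (inj₁ (p , q)) = inj₂ (q , p)
  Joins-sym (inj₂ (p , q)) = inj₁ (q , p)

  Joins⇒Incident : ∀ {e x y} → Joins e x y → Incident end₁ end₂ x e
  Joins⇒Incident = Sum.map proj₁ proj₁

  -- Kept abstract: unfolding this witness inside neighbour makes later goals intractably large.
  abstract
    edge-of-colour : ∀ v c → ∃[ e ] colour e ≡ c × Incident end₁ end₂ v e
    edge-of-colour v c = covering (filter Incident? (allFin numEdges)) (regular v)
                           (filter⁺ Incident? (allFin⁺ numEdges))
                           (proj₂ ∘ ∈-filter⁻ Incident? {xs = allFin numEdges})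
      where
      Incident? : Decidable (Incident end₁ end₂ v)
      Incident? e = (end₁ e ≟ v) ⊎-dec (end₂ e ≟ v)

      covering : ∀ xs → length xs ≡ 3 → Unique xs → (∀ {e} → e ∈ xs → Incident end₁ end₂ v e) →
                 ∃[ e ] colour e ≡ c × Incident end₁ end₂ v e
      covering (a ∷ b ∷ d ∷ []) refl ((a≢b ∷ a≢d ∷ []) ∷ (b≢d ∷ []) ∷ [] ∷ []) incident
        with Fin3-covered (colour a) (colour b) (colour d) c
               (proper v a b a≢b (incident (here refl)) (incident (there (here refl))))
               (proper v a d a≢d (incident (here refl)) (incident (there (there (here refl)))))
               (proper v b d b≢d (incident (there (here refl))) (incident (there (there (here refl)))))
      ... | inj₁ c≡a        = a , sym c≡a , incident (here refl)
      ... | inj₂ (inj₁ c≡b) = b , sym c≡b , incident (there (here refl))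
      ... | inj₂ (inj₂ c≡d) = d , sym c≡d , incident (there (there (here refl)))

  colourEdge : Fin n → Fin 3 → Fin numEdges
  colourEdge v c = proj₁ (edge-of-colour v c)

  colour-colourEdge : ∀ v c → colour (colourEdge v c) ≡ c
  colour-colourEdge v c = proj₁ (proj₂ (edge-of-colour v c))

  colourEdge-unique : ∀ {v c e} → colour e ≡ c → Incident end₁ end₂ v e → e ≡ colourEdge v c
  colourEdge-unique {v} {c} {e} colour≡c incident with e ≟ colourEdge v c
  ... | yes e≡ = e≡
  ... | no e≢  = ⊥-elim (proper v e (colourEdge v c) e≢ incident (proj₂ (proj₂ (edge-of-colour v c)))
                                (trans colour≡c (sym (colour-colourEdge v c))))

  other : Fin numEdges → Fin n → Fin n
  other e x = if does (end₁ e ≟ x) then end₂ e else end₁ e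

  other-joins : ∀ {e x y} → Joins e x y → other e x ≡ y
  other-joins {e} {x} (inj₁ (p , q)) rewrite dec-true (end₁ e ≟ x) p = q
  other-joins {e} {x} (inj₂ (p , q)) rewrite dec-false (end₁ e ≟ x) (λ p′ → loopless e (trans p′ (sym p))) = q

  Incident⇒Joins : ∀ {e x} → Incident end₁ end₂ x e → Joins e x (other e x)
  Incident⇒Joins (inj₁ p) = inj₁ (p , sym (other-joins (inj₁ (p , refl))))
  Incident⇒Joins (inj₂ p) = inj₂ (p , sym (other-joins (inj₂ (p , refl))))

  neighbour : Fin 3 → Fin n → Fin n
  neighbour c v = other (colourEdge v c) v

  neighbour-joins : ∀ c v → Joins (colourEdge v c) v (neighbour c v)
  neighbour-joins c v = Incident⇒Joins (proj₂ (proj₂ (edge-of-colour v c)))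

  Joins⇒neighbour : ∀ {e x y} → Joins e x y → y ≡ neighbour (colour e) x
  Joins⇒neighbour {e} {x} joins =
    trans (sym (other-joins joins)) (cong (λ f → other f x) (colourEdge-unique refl (Joins⇒Incident joins)))

  neighbour-involutive : ∀ c v → neighbour c (neighbour c v) ≡ v
  neighbour-involutive c v = sym (trans (Joins⇒neighbour (Joins-sym (neighbour-joins c v)))
                                        (cong (λ c′ → neighbour c′ (neighbour c v)) (colour-colourEdge v c)))

  neighbour-injective : ∀ c {x y} → neighbour c x ≡ neighbour c y → x ≡ y
  neighbour-injective c {x} {y} eq =
    trans (sym (neighbour-involutive c x)) (trans (cong (neighbour c) eq) (neighbour-involutive c y))

  module Bipartition (side : Fin n → Bool) (bipartite : ∀ e → side (end₁ e) ≢ side (end₂ e)) where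

    Joins⇒side-flip : ∀ {e x y} → Joins e x y → side y ≡ not (side x)
    Joins⇒side-flip {e} (inj₁ (refl , refl)) = ¬-not (bipartite e ∘ sym)
    Joins⇒side-flip {e} (inj₂ (refl , refl)) = ¬-not (bipartite e)

    side-neighbour : ∀ c v → side (neighbour c v) ≡ not (side v)
    side-neighbour c v = Joins⇒side-flip (neighbour-joins c v)

    side-neighbour² : ∀ i j v → side (neighbour j (neighbour i v)) ≡ side v
    side-neighbour² i j v rewrite side-neighbour j (neighbour i v) | side-neighbour i v = not-involutive (side v)

    black-vertex : Fin n → ∃[ u ] side u ≡ true
    black-vertex v with side v in eq
    ... | true  = v , eq
    ... | false = neighbour 0F v , trans (side-neighbour 0F v) (cong not eq)

    rotate : Fin 3 → Fin 3 → Fin n → Fin n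
    rotate i j v = if side v then neighbour j (neighbour i v) else v

    rotate-black : ∀ i j {v} → side v ≡ true → rotate i j v ≡ neighbour j (neighbour i v)
    rotate-black i j black rewrite black = refl

    rotate-white : ∀ i j {v} → side v ≡ false → rotate i j v ≡ v
    rotate-white i j white rewrite white = refl

    side-rotate : ∀ i j v → side (rotate i j v) ≡ side v
    side-rotate i j v with side v in eq
    ... | true  = trans (side-neighbour² i j v) eq
    ... | false = eq

    rotate-inverse : ∀ i j v → rotate j i (rotate i j v) ≡ v
    rotate-inverse i j v with side v in eq
    ... | true  = begin
      rotate j i (neighbour j (neighbour i v))                 ≡⟨ rotate-black j i (trans (side-neighbour² i j v) eq) ⟩
      neighbour i (neighbour j (neighbour j (neighbour i v)))  ≡⟨ cong (neighbour i) (neighbour-involutive j _) ⟩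
      neighbour i (neighbour i v)                              ≡⟨ neighbour-involutive i v ⟩
      v                                                        ∎
    ... | false = rotate-white j i eq

    rotation : Fin 3 → Fin 3 → Permutation′ n
    rotation i j = permutation (rotate i j) (rotate j i) (rotate-inverse j i) (rotate-inverse i j)

    rotation-∘ₚ : ∀ i j k → rotation i j ∘ₚ rotation j k ≈ rotation i k
    rotation-∘ₚ i j k v with side v in eq
    ... | true  = begin
      rotate j k (neighbour j (neighbour i v))                 ≡⟨ rotate-black j k (trans (side-neighbour² i j v) eq) ⟩
      neighbour k (neighbour j (neighbour j (neighbour i v)))  ≡⟨ cong (neighbour k) (neighbour-involutive j _) ⟩
      neighbour k (neighbour i v)                              ∎
    ... | false = rotate-white j k eq

    module RotationOrbit {i j : Fin 3} (connected : ConnectedIJ G i j) {u : Fin n} (u-black : side u ≡ true) where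

      ρ : Permutation′ n
      ρ = rotation i j

      open Orbit ρ u public

      orbit-black : ∀ k → side (orbit ρ u k) ≡ true
      orbit-black zero    = u-black
      orbit-black (suc k) = trans (side-rotate i j _) (orbit-black k)

      orbit≢neighbour : ∀ k l → orbit ρ u k ≢ neighbour i (orbit ρ u l)
      orbit≢neighbour k l eq with () ← trans (sym (orbit-black k))
                                       (trans (cong side eq) (trans (side-neighbour i _) (cong not (orbit-black l))))

      Reached : Fin n → Set
      Reached v = (∃[ k ] orbit ρ u k ≡ v) ⊎ (∃[ k ] neighbour i (orbit ρ u k) ≡ v)

      Reached-neighbour : ∀ {c x} → c ≡ i ⊎ c ≡ j → Reached x → Reached (neighbour c x)
      Reached-neighbour (inj₁ refl) (inj₁ (k , refl)) = inj₂ (k , refl)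
      Reached-neighbour (inj₂ refl) (inj₁ (k , refl)) with k′ , eq ← predecessor k = inj₂ (k′ , (begin
        neighbour i (orbit ρ u k′)                               ≡⟨ neighbour-involutive j _ ⟨
        neighbour j (neighbour j (neighbour i (orbit ρ u k′)))  ≡⟨ cong (neighbour j) (rotate-black i j (orbit-black k′)) ⟨
        neighbour j (orbit ρ u (suc k′))                         ≡⟨ cong (neighbour j) eq ⟩
        neighbour j (orbit ρ u k)                                ∎))
      Reached-neighbour (inj₁ refl) (inj₂ (k , refl)) = inj₁ (k , sym (neighbour-involutive i _))
      Reached-neighbour (inj₂ refl) (inj₂ (k , refl)) = inj₁ (suc k , rotate-black i j (orbit-black k))

      Walk⇒Reached : ∀ {x y} → Walk G i j x y → Reached x → Reached y
      Walk⇒Reached here r = r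
      Walk⇒Reached (step e colour-ij joins walk) r =
        Walk⇒Reached walk (subst Reached (sym (Joins⇒neighbour joins)) (Reached-neighbour colour-ij r))

      reached : ∀ v → Reached v
      reached v = Walk⇒Reached (connected u v) (inj₁ (zero , refl))

      isCycle : IsCycle ρ u L
      isCycle = record { closes = closes ; distinct = distinct ; support = support }
        where
        support : ∀ v → (∃[ k ] k ≤ L × orbit ρ u k ≡ v) ⊎ rotate i j v ≡ v
        support v with side v in eq | reached v
        ... | false | _               = inj₂ refl
        ... | true  | inj₁ (k , refl) with k′ , k′≤L , eq′ ← reduce k = inj₁ (k′ , k′≤L , sym eq′)
        ... | true  | inj₂ (k , refl) with () ← trans (sym eq) (trans (side-neighbour i _) (cong not (orbit-black k)))

      orbit-size : suc L + suc L ≡ n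
      orbit-size = ↔⇒≡ (enumeration ↔-∘ +↔⊎)
        where
        enumerate : Fin (suc L) ⊎ Fin (suc L) → Fin n
        enumerate (inj₁ a) = orbit ρ u (toℕ a)
        enumerate (inj₂ a) = neighbour i (orbit ρ u (toℕ a))

        orbit-injective : ∀ a b → orbit ρ u (toℕ a) ≡ orbit ρ u (toℕ b) → a ≡ b
        orbit-injective a b eq = toℕ-injective (distinct (≤-pred (toℕ<n a)) (≤-pred (toℕ<n b)) eq)

        enumerate-injective : ∀ {s t} → enumerate s ≡ enumerate t → s ≡ t
        enumerate-injective {inj₁ a} {inj₁ b} eq = cong inj₁ (orbit-injective a b eq)
        enumerate-injective {inj₁ a} {inj₂ b} eq = ⊥-elim (orbit≢neighbour (toℕ a) (toℕ b) eq)
        enumerate-injective {inj₂ a} {inj₁ b} eq = ⊥-elim (orbit≢neighbour (toℕ b) (toℕ a) (sym eq))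
        enumerate-injective {inj₂ a} {inj₂ b} eq = cong inj₂ (orbit-injective a b (neighbour-injective i eq))

        position : ℕ → Fin (suc L)
        position k = fromℕ< (s≤s (proj₁ (proj₂ (reduce k))))

        orbit-position : ∀ k → orbit ρ u (toℕ (position k)) ≡ orbit ρ u k
        orbit-position k = trans (cong (orbit ρ u) (toℕ-fromℕ< (s≤s (proj₁ (proj₂ (reduce k))))))
                                 (sym (proj₂ (proj₂ (reduce k))))

        locate : ∀ {v} → Reached v → Fin (suc L) ⊎ Fin (suc L)
        locate (inj₁ (k , _)) = inj₁ (position k)
        locate (inj₂ (k , _)) = inj₂ (position k)

        enumerate-locate : ∀ {v} (r : Reached v) → enumerate (locate r) ≡ v
        enumerate-locate (inj₁ (k , eq)) = trans (orbit-position k) eq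
        enumerate-locate (inj₂ (k , eq)) = trans (cong (neighbour i) (orbit-position k)) eq

        enumeration : (Fin (suc L) ⊎ Fin (suc L)) ↔ Fin n
        enumeration = mk↔ₛ′ enumerate (locate ∘ reached)
          (λ v → enumerate-locate (reached v))
          (λ s → enumerate-injective (enumerate-locate (reached (enumerate s))))

    sgn-rotation : ∀ {i j} → ConnectedIJ G i j → ∀ k → n ≡ suc k + suc k → sgn (rotation i j) ≡ parity k
    sgn-rotation connected k n≡ = begin
      sgn ρ     ≡⟨ sgn-cycle L isCycle ⟩
      parity L  ≡⟨ cong parity (suc-injective (m+m≡n+n⇒m≡n (trans orbit-size n≡))) ⟩
      parity k  ∎
      where open RotationOrbit connected (proj₂ (black-vertex (subst Fin (sym n≡) zero)))

four-halves : ∀ m → 4 * suc m ≡ suc (suc (m + m)) + suc (suc (m + m))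
four-halves m = begin
  4 * suc m                              ≡⟨ cong (λ z → suc m + (suc m + (suc m + z))) (+-identityʳ (suc m)) ⟩
  suc m + (suc m + (suc m + suc m))      ≡⟨ +-assoc (suc m) (suc m) (suc m + suc m) ⟨
  (suc m + suc m) + (suc m + suc m)      ≡⟨ cong (λ z → z + z) (cong suc (+-suc m m)) ⟩
  suc (suc (m + m)) + suc (suc (m + m))  ∎

lemma3p2 : (m : ℕ) → 1 ≤ m → (G : ColoredGraph (4 * m)) →
           ¬ (Bipartite G × Contracted G)
lemma3p2 (suc m) _ G ((side , bipartite) , contracted) = contradiction odd≡even λ ()
  where
  open Bipartition G side bipartite

  rotation-odd : ∀ i j → i ≢ j → sgn (rotation i j) ≡ 1ℙ
  rotation-odd i j i≢j = trans (sgn-rotation (contracted i j i≢j) (suc (m + m)) (four-halves m)) (parity-odd m)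

  odd≡even : 1ℙ ≡ 0ℙ
  odd≡even = begin
    1ℙ
      ≡⟨ rotation-odd 0F 2F (λ ()) ⟨
    sgn (rotation 0F 2F)
      ≡⟨ sgn-cong {π = rotation 0F 1F ∘ₚ rotation 1F 2F} {rotation 0F 2F} (rotation-∘ₚ 0F 1F 2F) ⟨
    sgn (rotation 0F 1F ∘ₚ rotation 1F 2F)
      ≡⟨ sgn-∘ₚ (rotation 0F 1F) (rotation 1F 2F) ⟩
    sgn (rotation 0F 1F) ℙ.+ sgn (rotation 1F 2F)
      ≡⟨ cong₂ ℙ._+_ (rotation-odd 0F 1F (λ ())) (rotation-odd 1F 2F (λ ())) ⟩
    0ℙ
      ∎
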